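{- Let $\Sigma$ be a finite alphabet with $q>1$ letters. For $n\in\mathbb{N}$ let $B(n)$ denote the number of closed words of length $n$ over $\Sigma$. Then there is a constant $c\in\mathbb{R}^+$ (possibly depending on $q$) such that \[B(n)\leq c\ln{n}\,\frac{q^{n}}{\sqrt{n}}\quad\text{for all } n>1.\]
   Context: A non-empty word $w$ is a border of the word $u$ if $|w|<|u|$ and $w$ is both a prefix and a suffix of $u$. A word $u$ having a border $w$ is closed if $u$ contains exactly two occurrences of $w$ as a factor (i.e. $w$ occurs only as a prefix and as a suffix of $u$). $\mathbb{N}$ denotes the set of positive integers and $\mathbb{R}^+$ the set of positive reals. -}

module Defs where

open import Data.Bool using (Bool; true; false; _∧_; _∨_; if_then_else_)
open import Data.Nat using (ℕ; zero; suc; _+_; _∸_; _≡ᵇ_; _<ᵇ_)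
open import Data.Fin using (Fin)
open import Data.List using (List; []; _∷_; length; take; drop; map; concatMap; filterᵇ; upTo)
open import Data.Bool.ListAction using (any)
open import Data.List.Properties using (≡-dec)
open import Data.Fin.Properties using (_≟_)
open import Relation.Nullary.Decidable using (⌊_⌋)

Word : ℕ → Set
Word q = List (Fin q)

_==_ : ∀ {q} → Word q → Word q → Bool
u == v = ⌊ ≡-dec _≟_ u v ⌋

allFinL : (q : ℕ) → List (Fin q)
allFinL q = Data.List.allFin q

wordsOfLength : (q : ℕ) → ℕ → List (Word q)
wordsOfLength q zero = [] ∷ []
wordsOfLength q (suc n) = concatMap (λ a → map (a ∷_) (wordsOfLength q n)) (allFinL q)

occurrences : ∀ {q} → Word q → Word q → ℕ
occurrences w u =
  length (filterᵇ (λ i → ((i + length w) Data.Nat.≤ᵇ length u) ∧ (take (length w) (drop i u) == w))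
                  (upTo (suc (length u))))

-- The border of length k is necessarily  take k u.
isClosed : ∀ {q} → Word q → Bool
isClosed u = any (λ k → (0 <ᵇ k) ∧ (k <ᵇ length u)
                        ∧ (take k u == drop (length u ∸ k) u)
                        ∧ (occurrences (take k u) u ≡ᵇ 2))
                 (upTo (length u))

B : (q : ℕ) → ℕ → ℕ
B q n = length (filterᵇ isClosed (wordsOfLength q n))

-- Let N k count the words of length n with a closed border of length k, so B(n) ≤ Σₖ N k.
-- A border of length k makes the word periodic with period n − k, hence N k ≤ q^(n−k).
-- Writing n = k + m k + ℓ with ℓ ≥ 1, none of the m length-k blocks following the border
-- equals it (that would be a third occurrence), hence N k ≤ q^k (q^k − 1)^m q^ℓ.
-- For s = ⌊√n⌋ and k q^k ≤ s, the choice m = q^k (s − 2) and (1 − q^−k)^(q^k) ≤ 1/2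
-- give s N k ≤ 4 q^n. From the least K with s < K q^K on, the first bound sums geometrically
-- to 2 q^(n−K) ≤ 2 K q^n / s, and K ≤ ⌊log₂ n⌋ + 1. Hence s B(n) ≤ 12 ⌊log₂ n⌋ q^n, and
-- squaring with n < (s + 1)² ≤ 4 s² gives the constant 576.

module Submission where

open import Defs
open import Data.Bool using (Bool; true; false; T; not; _∧_; _∨_; if_then_else_)
open import Data.Bool.ListAction using (any)
open import Data.Bool.Properties using (T-∧)
open import Data.Fin using (Fin; zero; suc; toℕ; punchIn)
open import Data.Fin.Properties using (punchInᵢ≢i; toℕ<n) renaming (_≟_ to _≟ᶠ_)
open import Data.List using (List; []; _∷_; length; take; drop; map; concatMap; filterᵇ; tabulate; upTo; applyUpTo; _++_)
import Data.List.Properties as List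
open import Data.Nat
open import Data.Nat.Logarithm using (⌊log₂_⌋; ⌊log₂⌋-mono-≤; ⌊log₂[2^n]⌋≡n)
open import Data.Nat.Properties
open import Data.Nat.Tactic.RingSolver using (solve-∀)
open import Data.Product using (Σ; _,_; _×_)
open import Data.Sum using (_⊎_; inj₁; inj₂; [_,_])
open import Function using (_∘_; Equivalence)
open import Relation.Binary.PropositionalEquality hiding ([_])
open import Relation.Nullary using (¬_; yes; no; contradiction)
open import Relation.Nullary.Decidable using (T?; toWitness; fromWitness; fromWitnessFalse)
open import Relation.Unary using (Decidable)
open import Algebra.Properties.Semiring.Sum +-*-semiring
  using (sum; sum-syntax; sum-remove; sum-cong-≗; ∑-distrib-+; *-distribˡ-sum; *-distribʳ-sum)
open import Algebra.Properties.CommutativeSemigroup *-commutativeSemigroup using (x∙yz≈y∙xz)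

∑-mono-≤ : ∀ {n} {f g : Fin n → ℕ} → (∀ i → f i ≤ g i) → sum f ≤ sum g
∑-mono-≤ {zero}  _   = z≤n
∑-mono-≤ {suc n} f≤g = +-mono-≤ (f≤g zero) (∑-mono-≤ (f≤g ∘ suc))

∑-const : ∀ n c → ∑[ i < n ] c ≡ n * c
∑-const zero    c = refl
∑-const (suc n) c = cong (c +_) (∑-const n c)

term≤∑ : ∀ {n} (f : Fin n → ℕ) i → f i ≤ sum f
term≤∑ {suc n} f i = ≤-trans (m≤m+n (f i) _) (≤-reflexive (sym (sum-remove f)))

∑-single : ∀ {n} (f : Fin n → ℕ) i → (∀ j → j ≢ i → f j ≡ 0) → sum f ≡ f i
∑-single {suc n} f i vanish = begin
  sum f                     ≡⟨ sum-remove f ⟩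
  f i + ∑[ j < n ] f (punchIn i j)
    ≡⟨ cong (f i +_) (sum-cong-≗ (λ j → vanish _ (punchInᵢ≢i i j))) ⟩
  f i + ∑[ j < n ] 0        ≡⟨ cong (f i +_) (trans (∑-const n 0) (*-zeroʳ n)) ⟩
  f i + 0                   ≡⟨ +-identityʳ (f i) ⟩
  f i                       ∎
  where open ≡-Reasoning

sumBelow : (ℕ → ℕ) → ℕ → ℕ
sumBelow f n = ∑[ i < n ] f (toℕ i)

sumBelow-mono-≤ : ∀ {f g} n → (∀ k → k < n → f k ≤ g k) → sumBelow f n ≤ sumBelow g n
sumBelow-mono-≤ n f≤g = ∑-mono-≤ (λ i → f≤g (toℕ i) (toℕ<n i))

sumBelow-≤-const : ∀ {f} n b → (∀ k → k < n → f k ≤ b) → sumBelow f n ≤ n * b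
sumBelow-≤-const n b f≤b = ≤-trans (sumBelow-mono-≤ n f≤b) (≤-reflexive (∑-const n b))

sumBelow-+ : ∀ f a d → sumBelow f (a + d) ≡ sumBelow f a + sumBelow (λ j → f (a + j)) d
sumBelow-+ f zero    d = refl
sumBelow-+ f (suc a) d = trans (cong (f 0 +_) (sumBelow-+ (f ∘ suc) a d)) (sym (+-assoc (f 0) _ _))

*-distribˡ-sumBelow : ∀ c f n → c * sumBelow f n ≡ sumBelow (λ k → c * f k) n
*-distribˡ-sumBelow c f n = *-distribˡ-sum {n} c (f ∘ toℕ)

sumBelow-geometric : ∀ {q} → 2 ≤ q → ∀ c {f} d → (∀ j → j < d → f j ≤ c * q ^ (d ∸ j)) →
  sumBelow f d ≤ 2 * c * q ^ d
sumBelow-geometric q≥2 c zero    _     = z≤n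
sumBelow-geometric {q} q≥2 c {f} (suc d) f≤ = begin
  f 0 + sumBelow (f ∘ suc) d         ≤⟨ +-mono-≤ (f≤ 0 z<s) (sumBelow-geometric q≥2 c d (λ j → f≤ (suc j) ∘ s<s)) ⟩
  c * q ^ suc d + 2 * c * q ^ d      ≡⟨ regroup c (q ^ d) ⟩
  c * (q * q ^ d) + c * (2 * q ^ d)  ≤⟨ +-monoʳ-≤ (c * (q * q ^ d)) (*-monoʳ-≤ c (*-monoˡ-≤ (q ^ d) q≥2)) ⟩
  c * (q * q ^ d) + c * (q * q ^ d)  ≡⟨ double c (q * q ^ d) ⟩
  2 * c * q ^ suc d                  ∎
  where
  open ≤-Reasoning
  regroup : ∀ c x → c * (q * x) + 2 * c * x ≡ c * (q * x) + c * (2 * x)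
  regroup = solve-∀
  double : ∀ c y → c * y + c * y ≡ 2 * c * y
  double = solve-∀

sumBelow-≤-threshold : ∀ {q} → 2 ≤ q → ∀ {f} n K b c → K ≤ n →
  (∀ k → k < K → f k ≤ b) → (∀ k → K ≤ k → k < n → f k ≤ c * q ^ (n ∸ k)) →
  sumBelow f n ≤ K * b + 2 * c * q ^ (n ∸ K)
sumBelow-≤-threshold {q} q≥2 {f} n K b c K≤n below above = begin
  sumBelow f n                                       ≡⟨ cong (sumBelow f) (m+[n∸m]≡n K≤n) ⟨
  sumBelow f (K + (n ∸ K))                           ≡⟨ sumBelow-+ f K (n ∸ K) ⟩
  sumBelow f K + sumBelow (λ j → f (K + j)) (n ∸ K)  ≤⟨ +-mono-≤ (sumBelow-≤-const K b below) (sumBelow-geometric q≥2 c (n ∸ K) tail) ⟩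
  K * b + 2 * c * q ^ (n ∸ K)                        ∎
  where
  open ≤-Reasoning
  tail : ∀ j → j < n ∸ K → f (K + j) ≤ c * q ^ (n ∸ K ∸ j)
  tail j j<n∸K = subst (λ e → f (K + j) ≤ c * q ^ e) (sym (∸-+-assoc n K j))
    (above (K + j) (m≤m+n K j) (subst (K + j <_) (m+[n∸m]≡n K≤n) (+-monoʳ-< K j<n∸K)))

^-distribʳ-* : ∀ m n o → (m * n) ^ o ≡ m ^ o * n ^ o
^-distribʳ-* m n zero    = refl
^-distribʳ-* m n (suc o) = trans (cong (m * n *_) (^-distribʳ-* m n o)) (swap m n (m ^ o) (n ^ o))
  where
  swap : ∀ a b c d → a * b * (c * d) ≡ a * c * (b * d)
  swap = solve-∀

-- Bernoulli's inequality (1 + 1/a)^j ≥ 1 + j/a, cleared of denominators.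
a^j*[a+j]≤a*[1+a]^j : ∀ a j → a ^ j * (a + j) ≤ a * suc a ^ j
a^j*[a+j]≤a*[1+a]^j a zero    = ≤-reflexive (trans (+-identityʳ (a + 0)) (trans (+-identityʳ a) (sym (*-identityʳ a))))
a^j*[a+j]≤a*[1+a]^j a (suc j) = begin
  a * a ^ j * (a + suc j)                   ≡⟨ split a (a ^ j) j ⟩
  a * a ^ j * (a + j) + a * a ^ j           ≤⟨ +-monoʳ-≤ (a * a ^ j * (a + j)) (≤-trans (≤-reflexive (*-comm a (a ^ j))) (*-monoʳ-≤ (a ^ j) (m≤m+n a j))) ⟩
  a * a ^ j * (a + j) + a ^ j * (a + j)     ≡⟨ merge a (a ^ j) j ⟩
  suc a * (a ^ j * (a + j))                 ≤⟨ *-monoʳ-≤ (suc a) (a^j*[a+j]≤a*[1+a]^j a j) ⟩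
  suc a * (a * suc a ^ j)                   ≡⟨ x∙yz≈y∙xz (suc a) a (suc a ^ j) ⟩
  a * (suc a * suc a ^ j)                   ∎
  where
  open ≤-Reasoning
  split : ∀ a x j → a * x * (a + suc j) ≡ a * x * (a + j) + a * x
  split = solve-∀
  merge : ∀ a x j → a * x * (a + j) + x * (a + j) ≡ suc a * (x * (a + j))
  merge = solve-∀

2*a^[1+a]≤[1+a]^[1+a] : ∀ a → 2 * a ^ suc a ≤ suc a ^ suc a
2*a^[1+a]≤[1+a]^[1+a] zero        = z≤n
2*a^[1+a]≤[1+a]^[1+a] a@(suc _) = *-cancelˡ-≤ a (begin
  a * (2 * a ^ suc a)          ≡⟨ rearrange a (a ^ suc a) ⟩
  a ^ suc a * (a + a)          ≤⟨ *-monoʳ-≤ (a ^ suc a) (+-monoʳ-≤ a (n≤1+n a)) ⟩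
  a ^ suc a * (a + suc a)      ≤⟨ a^j*[a+j]≤a*[1+a]^j a (suc a) ⟩
  a * suc a ^ suc a            ∎)
  where
  open ≤-Reasoning
  rearrange : ∀ a x → a * (2 * x) ≡ x * (a + a)
  rearrange = solve-∀

2^t*[Q∸1]^[Q*t]≤Q^[Q*t] : ∀ {Q} t → 1 ≤ Q → 2 ^ t * (Q ∸ 1) ^ (Q * t) ≤ Q ^ (Q * t)
2^t*[Q∸1]^[Q*t]≤Q^[Q*t] {suc a} t _ = begin
  2 ^ t * a ^ (suc a * t)        ≡⟨ cong (2 ^ t *_) (^-*-assoc a (suc a) t) ⟨
  2 ^ t * (a ^ suc a) ^ t        ≡⟨ ^-distribʳ-* 2 (a ^ suc a) t ⟨
  (2 * a ^ suc a) ^ t            ≤⟨ ^-monoˡ-≤ t (2*a^[1+a]≤[1+a]^[1+a] a) ⟩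
  (suc a ^ suc a) ^ t            ≡⟨ ^-*-assoc (suc a) (suc a) t ⟩
  suc a ^ (suc a * t)            ∎
  where open ≤-Reasoning

2≤q^k : ∀ {q k} → 2 ≤ q → 1 ≤ k → 2 ≤ q ^ k
2≤q^k {q} {suc k} q≥2 _ = *-mono-≤ q≥2 (m^n>0 q {{>-nonZero (≤-trans (s≤s z≤n) q≥2)}} k)

n≤4*2^[n∸2] : ∀ n → n ≤ 4 * 2 ^ (n ∸ 2)
n≤4*2^[n∸2] zero          = z≤n
n≤4*2^[n∸2] (suc zero)    = s≤s z≤n
n≤4*2^[n∸2] (suc (suc n)) = go n
  where
  go : ∀ n → 2 + n ≤ 4 * 2 ^ n
  go zero    = s≤s (s≤s z≤n)
  go (suc n) = begin
    3 + n              ≤⟨ m≤m+n (3 + n) (1 + n) ⟩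
    3 + n + (1 + n)    ≡⟨ twice n ⟩
    2 * (2 + n)        ≤⟨ *-monoʳ-≤ 2 (go n) ⟩
    2 * (4 * 2 ^ n)    ≡⟨ x∙yz≈y∙xz 2 4 (2 ^ n) ⟩
    4 * (2 * 2 ^ n)    ∎
    where
    open ≤-Reasoning
    twice : ∀ n → 3 + n + (1 + n) ≡ 2 * (2 + n)
    twice = solve-∀

record LeastWitness (P : ℕ → Set) : Set where
  constructor least
  field
    value   : ℕ
    holds   : P value
    minimal : ∀ {j} → j < value → ¬ P j

leastWitness : ∀ {P : ℕ → Set} → Decidable P → ∀ N → P N → LeastWitness P
leastWitness {P} P? N PN with search (suc N)
  where
  search : ∀ M → (∀ {j} → j < M → ¬ P j) ⊎ LeastWitness P
  search zero = inj₁ λ ()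
  search (suc M) with search M
  ... | inj₂ w    = inj₂ w
  ... | inj₁ none with P? M
  ...   | yes PM  = inj₂ (least M PM none)
  ...   | no ¬PM  = inj₁ λ j<1+M → [ none , (λ { refl → ¬PM }) ] (m<1+n⇒m<n∨m≡n j<1+M)
... | inj₂ w    = w
... | inj₁ none = contradiction PN (none (n<1+n N))

√-bounds : ∀ n → Σ ℕ (λ s → s * s ≤ n × n < suc s * suc s)
√-bounds n with leastWitness (λ t → n <? t * t) (suc n) (≤-trans (n<1+n n) (m≤m+n (suc n) (n * suc n)))
... | least (suc s) n<[1+s]² below = s , ≮⇒≥ (below ≤-refl) , n<[1+s]²

n<2^[1+⌊log₂n⌋] : ∀ n → n < 2 ^ suc ⌊log₂ n ⌋
n<2^[1+⌊log₂n⌋] n = ≰⇒> λ 2^[1+L]≤n →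
  1+n≰n (subst (_≤ ⌊log₂ n ⌋) (⌊log₂[2^n]⌋≡n (suc ⌊log₂ n ⌋)) (⌊log₂⌋-mono-≤ 2^[1+L]≤n))

n<[1+⌊log₂n⌋]*q^[1+⌊log₂n⌋] : ∀ {q} → 2 ≤ q → ∀ n → n < suc ⌊log₂ n ⌋ * q ^ suc ⌊log₂ n ⌋
n<[1+⌊log₂n⌋]*q^[1+⌊log₂n⌋] {q} q≥2 n = begin-strict
  n                   <⟨ n<2^[1+⌊log₂n⌋] n ⟩
  2 ^ suc L           ≤⟨ ^-monoˡ-≤ (suc L) q≥2 ⟩
  q ^ suc L           ≤⟨ m≤n*m (q ^ suc L) (suc L) ⟩
  suc L * q ^ suc L   ∎
  where
  open ≤-Reasoning
  L = ⌊log₂ n ⌋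

1≤⌊log₂n⌋ : ∀ {n} → 2 ≤ n → 1 ≤ ⌊log₂ n ⌋
1≤⌊log₂n⌋ {n} n≥2 = subst (_≤ ⌊log₂ n ⌋) (⌊log₂[2^n]⌋≡n 1) (⌊log₂⌋-mono-≤ n≥2)

record Threshold (q s n : ℕ) : Set where
  field
    K          : ℕ
    K≤n        : K ≤ n
    K≤2⌊log₂n⌋ : K ≤ 2 * ⌊log₂ n ⌋
    s≤K*q^K    : s ≤ K * q ^ K
    below      : ∀ {k} → k < K → k * q ^ k ≤ s

threshold : ∀ {q s n} → 2 ≤ q → 2 ≤ n → s * s ≤ n → Threshold q s n
threshold {q} {s} {n} q≥2 n≥2 s²≤n = record
  { K          = value
  ; K≤n        = ≮⇒≥ (λ n<K → minimal n<K s<n*q^n)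
  ; K≤2⌊log₂n⌋ = begin
      value   ≤⟨ ≮⇒≥ (λ 1+L<K → minimal 1+L<K (≤-<-trans s≤n (n<[1+⌊log₂n⌋]*q^[1+⌊log₂n⌋] q≥2 n))) ⟩
      1 + L   ≤⟨ +-monoˡ-≤ L (1≤⌊log₂n⌋ n≥2) ⟩
      L + L   ≡⟨ cong (L +_) (+-identityʳ L) ⟨
      2 * L   ∎
  ; s≤K*q^K    = <⇒≤ holds
  ; below      = ≮⇒≥ ∘ minimal
  }
  where
  open ≤-Reasoning
  L = ⌊log₂ n ⌋
  s≤n : s ≤ n
  s≤n = ≤-trans (m≤m*m s) s²≤n
    where
    m≤m*m : ∀ m → m ≤ m * m
    m≤m*m zero       = z≤n
    m≤m*m m@(suc _) = m≤m*n m m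
  s<n*q^n : s < n * q ^ n
  s<n*q^n = ≤-<-trans s≤n (m<m*n n (q ^ n) {{>-nonZero (≤-trans (s≤s z≤n) n≥2)}} (2≤q^k q≥2 (≤-trans (s≤s z≤n) n≥2)))
  open LeastWitness (leastWitness (λ k → s <? k * q ^ k) n s<n*q^n)

module _ {A B : Set} (P : B → Bool) where

  length-filter-map : (g : A → B) (xs : List A) →
    length (filterᵇ P (map g xs)) ≡ length (filterᵇ (P ∘ g) xs)
  length-filter-map g [] = refl
  length-filter-map g (x ∷ xs) with P (g x)
  ... | true  = cong suc (length-filter-map g xs)
  ... | false = length-filter-map g xs

  length-filter-concatMap-tabulate : ∀ {m} (f : Fin m → A) (h : A → List B) →
    length (filterᵇ P (concatMap h (tabulate f))) ≡ ∑[ i < m ] length (filterᵇ P (h (f i)))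
  length-filter-concatMap-tabulate {zero}  f h = refl
  length-filter-concatMap-tabulate {suc m} f h = begin
    length (filterᵇ P (h (f zero) ++ concatMap h (tabulate (f ∘ suc))))
      ≡⟨ cong length (List.filter-++ (T? ∘ P) (h (f zero)) _) ⟩
    length (filterᵇ P (h (f zero)) ++ filterᵇ P (concatMap h (tabulate (f ∘ suc))))
      ≡⟨ List.length-++ (filterᵇ P (h (f zero))) ⟩
    length (filterᵇ P (h (f zero))) + length (filterᵇ P (concatMap h (tabulate (f ∘ suc))))
      ≡⟨ cong (length (filterᵇ P (h (f zero))) +_) (length-filter-concatMap-tabulate (f ∘ suc) h) ⟩
    ∑[ i < suc m ] length (filterᵇ P (h (f i))) ∎
    where open ≡-Reasoning

module _ {A : Set} where

  take-++ : ∀ {k} {v : List A} r → length v ≡ k → take k (v ++ r) ≡ v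
  take-++ {v = []}    r refl = refl
  take-++ {v = x ∷ v} r refl = cong (x ∷_) (take-++ r refl)

  drop-++ : ∀ {k} {v : List A} r → length v ≡ k → drop k (v ++ r) ≡ r
  drop-++ {v = []}    r refl = refl
  drop-++ {v = x ∷ v} r refl = drop-++ {v = v} r refl

indicator : Bool → ℕ
indicator b = if b then 1 else 0

indicator-mono : ∀ {b c} → (T b → T c) → indicator b ≤ indicator c
indicator-mono {false}         _   = z≤n
indicator-mono {true}  {true}  _   = ≤-refl
indicator-mono {true}  {false} b⇒c with () ← b⇒c _

indicator-true : ∀ {b} → T b → indicator b ≡ 1
indicator-true {true} _ = refl

indicator-false : ∀ {b} → ¬ T b → indicator b ≡ 0
indicator-false {false} _  = refl
indicator-false {true}  ¬b = contradiction _ ¬b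

indicator-∨ : ∀ b c → indicator (b ∨ c) ≤ indicator b + indicator c
indicator-∨ true  _ = s≤s z≤n
indicator-∨ false _ = ≤-refl

indicator-not : ∀ b → indicator b + indicator (not b) ≡ 1
indicator-not true  = refl
indicator-not false = refl

hits : (ℕ → Bool) → ℕ → ℕ
hits f N = length (filterᵇ f (upTo N))

hits-suc : ∀ f N → hits f (suc N) ≡ hits f N + indicator (f N)
hits-suc f N = begin
  length (filterᵇ f (upTo (suc N)))                   ≡⟨ cong (length ∘ filterᵇ f) (List.applyUpTo-∷ʳ (λ x → x) N) ⟨
  length (filterᵇ f (upTo N ++ N ∷ []))               ≡⟨ cong length (List.filter-++ (T? ∘ f) (upTo N) (N ∷ [])) ⟩
  length (filterᵇ f (upTo N) ++ filterᵇ f (N ∷ []))   ≡⟨ List.length-++ (filterᵇ f (upTo N)) ⟩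
  hits f N + length (filterᵇ f (N ∷ []))              ≡⟨ cong (hits f N +_) singleton ⟩
  hits f N + indicator (f N)                          ∎
  where
  open ≡-Reasoning
  singleton : length (filterᵇ f (N ∷ [])) ≡ indicator (f N)
  singleton with f N
  ... | true  = refl
  ... | false = refl

hits-mono : ∀ f {N M} → N ≤ M → hits f N ≤ hits f M
hits-mono f = go ∘ ≤⇒≤′
  where
  go : ∀ {N M} → N ≤′ M → hits f N ≤ hits f M
  go ≤′-refl           = ≤-refl
  go (≤′-step {M} N≤M) = ≤-trans (go N≤M) (≤-trans (m≤m+n _ _) (≤-reflexive (sym (hits-suc f M))))

hit : ∀ f {i N} → T (f i) → i < N → suc (hits f i) ≤ hits f N
hit f {i} {N} fi i<N = begin
  suc (hits f i)             ≡⟨ +-comm 1 (hits f i) ⟩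
  hits f i + 1               ≡⟨ cong (hits f i +_) (indicator-true fi) ⟨
  hits f i + indicator (f i) ≡⟨ hits-suc f i ⟨
  hits f (suc i)             ≤⟨ hits-mono f i<N ⟩
  hits f N                   ∎
  where open ≤-Reasoning

three-hits : ∀ f {i j l N} → i < j → j < l → l < N → T (f i) → T (f j) → T (f l) → 3 ≤ hits f N
three-hits f i<j j<l l<N fi fj fl =
  ≤-trans (s≤s (s≤s (s≤s z≤n)))
    (≤-trans (s≤s (s≤s (hit f fi i<j))) (≤-trans (s≤s (hit f fj j<l)) (hit f fl l<N)))

==⇒≡ : ∀ {q} {u v : Word q} → T (u == v) → u ≡ v
==⇒≡ {u = u} {v} = toWitness {a? = List.≡-dec _≟ᶠ_ u v}

≡⇒== : ∀ {q} {u v : Word q} → u ≡ v → T (u == v)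
≡⇒== {u = u} {v} = fromWitness {a? = List.≡-dec _≟ᶠ_ u v}

≢⇒not== : ∀ {q} {u v : Word q} → u ≢ v → T (not (u == v))
≢⇒not== {u = u} {v} = fromWitnessFalse {a? = List.≡-dec _≟ᶠ_ u v}

occursAt : ∀ {q} → Word q → Word q → ℕ → Bool
occursAt w u i = ((i + length w) ≤ᵇ length u) ∧ (take (length w) (drop i u) == w)

occurs : ∀ {q} {w u : Word q} {k} i → length w ≡ k → i + k ≤ length u → take k (drop i u) ≡ w → T (occursAt w u i)
occurs i refl fits w≡ = Equivalence.from T-∧ (≤⇒≤ᵇ fits , ≡⇒== w≡)

module Words (q : ℕ) where

  count : (Word q → Bool) → ℕ → ℕ
  count P n = length (filterᵇ P (wordsOfLength q n))

  count-[] : ∀ P → count P 0 ≡ indicator (P [])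
  count-[] P with P []
  ... | true  = refl
  ... | false = refl

  count-[]-≤1 : ∀ P → count P 0 ≤ 1
  count-[]-≤1 P with P []
  ... | true  = ≤-refl
  ... | false = z≤n

  count-∷ : ∀ P n → count P (suc n) ≡ ∑[ x < q ] count (λ w → P (x ∷ w)) n
  count-∷ P n = trans (length-filter-concatMap-tabulate P {q} (λ x → x) (λ a → map (a ∷_) (wordsOfLength q n)))
                      (sum-cong-≗ (λ x → length-filter-map P (x ∷_) (wordsOfLength q n)))

  count-mono : ∀ {P Q} n → (∀ u → length u ≡ n → T (P u) → T (Q u)) → count P n ≤ count Q n
  count-mono {P} {Q} zero P⇒Q = begin
    count P 0          ≡⟨ count-[] P ⟩
    indicator (P [])   ≤⟨ indicator-mono (P⇒Q [] refl) ⟩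
    indicator (Q [])   ≡⟨ count-[] Q ⟨
    count Q 0          ∎
    where open ≤-Reasoning
  count-mono {P} {Q} (suc n) P⇒Q = begin
    count P (suc n)                        ≡⟨ count-∷ P n ⟩
    ∑[ x < q ] count (λ w → P (x ∷ w)) n   ≤⟨ ∑-mono-≤ (λ x → count-mono n (λ u → P⇒Q (x ∷ u) ∘ cong suc)) ⟩
    ∑[ x < q ] count (λ w → Q (x ∷ w)) n   ≡⟨ count-∷ Q n ⟨
    count Q (suc n)                        ∎
    where open ≤-Reasoning

  count-none : ∀ {P} n → (∀ u → length u ≡ n → ¬ T (P u)) → count P n ≡ 0
  count-none {P} zero    ¬P = trans (count-[] P) (indicator-false (¬P [] refl))
  count-none {P} (suc n) ¬P = begin
    count P (suc n)                        ≡⟨ count-∷ P n ⟩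
    ∑[ x < q ] count (λ w → P (x ∷ w)) n   ≡⟨ sum-cong-≗ (λ x → count-none n (λ u → ¬P (x ∷ u) ∘ cong suc)) ⟩
    ∑[ x < q ] 0                           ≡⟨ ∑-const q 0 ⟩
    q * 0                                  ≡⟨ *-zeroʳ q ⟩
    0                                      ∎
    where open ≡-Reasoning

  count-all : ∀ n → count (λ _ → true) n ≡ q ^ n
  count-all zero    = refl
  count-all (suc n) = begin
    count (λ _ → true) (suc n)             ≡⟨ count-∷ (λ _ → true) n ⟩
    ∑[ x < q ] count (λ _ → true) n        ≡⟨ sum-cong-≗ {q} (λ _ → count-all n) ⟩
    ∑[ x < q ] (q ^ n)                     ≡⟨ ∑-const q (q ^ n) ⟩
    q * q ^ n                              ∎
    where open ≡-Reasoning

  count-∨ : ∀ P Q n → count (λ u → P u ∨ Q u) n ≤ count P n + count Q n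
  count-∨ P Q zero = begin
    count (λ u → P u ∨ Q u) 0              ≡⟨ count-[] (λ u → P u ∨ Q u) ⟩
    indicator (P [] ∨ Q [])                ≤⟨ indicator-∨ (P []) (Q []) ⟩
    indicator (P []) + indicator (Q [])    ≡⟨ cong₂ _+_ (count-[] P) (count-[] Q) ⟨
    count P 0 + count Q 0                  ∎
    where open ≤-Reasoning
  count-∨ P Q (suc n) = begin
    count (λ u → P u ∨ Q u) (suc n)
      ≡⟨ count-∷ (λ u → P u ∨ Q u) n ⟩
    ∑[ x < q ] count (λ w → P (x ∷ w) ∨ Q (x ∷ w)) n
      ≤⟨ ∑-mono-≤ (λ x → count-∨ (λ w → P (x ∷ w)) (λ w → Q (x ∷ w)) n) ⟩
    ∑[ x < q ] (count (λ w → P (x ∷ w)) n + count (λ w → Q (x ∷ w)) n)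
      ≡⟨ ∑-distrib-+ (λ x → count (λ w → P (x ∷ w)) n) (λ x → count (λ w → Q (x ∷ w)) n) ⟩
    ∑[ x < q ] count (λ w → P (x ∷ w)) n + ∑[ x < q ] count (λ w → Q (x ∷ w)) n
      ≡⟨ cong₂ _+_ (count-∷ P n) (count-∷ Q n) ⟨
    count P (suc n) + count Q (suc n) ∎
    where open ≤-Reasoning

  count-any≤sumBelow : ∀ (P : ℕ → Word q → Bool) g N n →
    count (λ u → any (λ k → P k u) (applyUpTo g N)) n ≤ sumBelow (λ k → count (P (g k)) n) N
  count-any≤sumBelow P g zero    n = ≤-reflexive (count-none n (λ _ _ ()))
  count-any≤sumBelow P g (suc N) n = ≤-trans (count-∨ (P (g 0)) _ n)
    (+-monoʳ-≤ (count (P (g 0)) n) (count-any≤sumBelow P (g ∘ suc) N n))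

  count-+-count-not : ∀ P n → count P n + count (not ∘ P) n ≡ q ^ n
  count-+-count-not P zero = trans (cong₂ _+_ (count-[] P) (count-[] (not ∘ P))) (indicator-not (P []))
  count-+-count-not P (suc n) = begin
    count P (suc n) + count (not ∘ P) (suc n)
      ≡⟨ cong₂ _+_ (count-∷ P n) (count-∷ (not ∘ P) n) ⟩
    ∑[ x < q ] count (λ w → P (x ∷ w)) n + ∑[ x < q ] count (λ w → not (P (x ∷ w))) n
      ≡⟨ ∑-distrib-+ (λ x → count (λ w → P (x ∷ w)) n) (λ x → count (λ w → not (P (x ∷ w))) n) ⟨
    ∑[ x < q ] (count (λ w → P (x ∷ w)) n + count (λ w → not (P (x ∷ w))) n)
      ≡⟨ sum-cong-≗ (λ x → count-+-count-not (λ w → P (x ∷ w)) n) ⟩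
    ∑[ x < q ] (q ^ n)
      ≡⟨ ∑-const q (q ^ n) ⟩
    q * q ^ n ∎
    where open ≡-Reasoning

  count-witness : ∀ P w → T (P w) → 1 ≤ count P (length w)
  count-witness P []      Pw = ≤-reflexive (sym (trans (count-[] P) (indicator-true Pw)))
  count-witness P (x ∷ w) Pw = begin
    1                                               ≤⟨ count-witness (λ r → P (x ∷ r)) w Pw ⟩
    count (λ r → P (x ∷ r)) (length w)              ≤⟨ term≤∑ (λ y → count (λ r → P (y ∷ r)) (length w)) x ⟩
    ∑[ y < q ] count (λ r → P (y ∷ r)) (length w)   ≡⟨ count-∷ P (length w) ⟨
    count P (suc (length w))                        ∎
    where open ≤-Reasoning

  count-fixed-head : ∀ P k a → (∀ x r → length r ≡ k → T (P (x ∷ r)) → x ≡ a) →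
    count P (suc k) ≡ count (λ r → P (a ∷ r)) k
  count-fixed-head P k a head≡a =
    trans (count-∷ P k) (∑-single _ a (λ x x≢a → count-none k (λ r lr → x≢a ∘ head≡a x r lr)))

  count-++-≤ : ∀ P G c a b → (∀ v → length v ≡ a → count (λ r → P (v ++ r)) b ≤ indicator (G v) * c) →
    count P (a + b) ≤ count G a * c
  count-++-≤ P G c zero b fibre = subst (λ z → count P b ≤ z * c) (sym (count-[] G)) (fibre [] refl)
  count-++-≤ P G c (suc a) b fibre = begin
    count P (suc a + b)
      ≡⟨ count-∷ P (a + b) ⟩
    ∑[ x < q ] count (λ w → P (x ∷ w)) (a + b)
      ≤⟨ ∑-mono-≤ (λ x → count-++-≤ (λ w → P (x ∷ w)) (λ v → G (x ∷ v)) c a b (λ v → fibre (x ∷ v) ∘ cong suc)) ⟩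
    ∑[ x < q ] (count (λ v → G (x ∷ v)) a * c)
      ≡⟨ *-distribʳ-sum c (λ x → count (λ v → G (x ∷ v)) a) ⟨
    ∑[ x < q ] count (λ v → G (x ∷ v)) a * c
      ≡⟨ cong (_* c) (count-∷ G a) ⟨
    count G (suc a) * c ∎
    where open ≤-Reasoning

  count-∧ : ∀ b P n → count (λ u → b ∧ P u) n ≤ indicator b * count P n
  count-∧ true  P n = ≤-reflexive (sym (+-identityʳ (count P n)))
  count-∧ false P n = ≤-reflexive (count-none n (λ _ _ ()))

  count-not-≤ : ∀ P w → T (P w) → count (not ∘ P) (length w) ≤ q ^ length w ∸ 1
  count-not-≤ P w Pw = begin
    count (not ∘ P) (length w)                                 ≡⟨ m+n∸m≡n (count P (length w)) _ ⟨
    count P (length w) + count (not ∘ P) (length w) ∸ count P (length w)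
      ≡⟨ cong (_∸ count P (length w)) (count-+-count-not P (length w)) ⟩
    q ^ length w ∸ count P (length w)                          ≤⟨ ∸-monoʳ-≤ (q ^ length w) (count-witness P w Pw) ⟩
    q ^ length w ∸ 1                                           ∎
    where open ≤-Reasoning

  -- A solution of r = take k (v ++ r) starts with the first letter of v, and its tail
  -- solves the same equation for v rotated by one letter.
  count-self-overlapping : ∀ k (v : Word q) → 1 ≤ length v → count (λ r → take k (v ++ r) == r) k ≤ 1
  count-self-overlapping zero    v       _ = count-[]-≤1 (λ r → take 0 (v ++ r) == r)
  count-self-overlapping (suc k) (a ∷ v) _ = begin
    count (λ r → take (suc k) (a ∷ v ++ r) == r) (suc k)
      ≡⟨ count-fixed-head _ k a (λ x r _ e → sym (List.∷-injectiveˡ (==⇒≡ e))) ⟩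
    count (λ r → take (suc k) (a ∷ v ++ a ∷ r) == (a ∷ r)) k
      ≤⟨ count-mono k (λ r _ e → ≡⇒== (trans (cong (take k) (List.++-assoc v (a ∷ []) r)) (List.∷-injectiveʳ (==⇒≡ e)))) ⟩
    count (λ r → take k ((v ++ a ∷ []) ++ r) == r) k
      ≤⟨ count-self-overlapping k (v ++ a ∷ []) (≤-trans (s≤s z≤n) (≤-reflexive (sym (List.length-++-sucʳ v a [])))) ⟩
    1 ∎
    where open ≤-Reasoning

  count-periodic : ∀ p k → 1 ≤ p → count (λ u → take k u == drop p u) (p + k) ≤ q ^ p
  count-periodic p k 1≤p = begin
    count (λ u → take k u == drop p u) (p + k)  ≤⟨ count-++-≤ _ (λ _ → true) 1 p k fibre ⟩
    count (λ _ → true) p * 1                    ≡⟨ *-identityʳ _ ⟩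
    count (λ _ → true) p                        ≡⟨ count-all p ⟩
    q ^ p                                       ∎
    where
    open ≤-Reasoning
    fibre : ∀ v → length v ≡ p → count (λ r → take k (v ++ r) == drop p (v ++ r)) k ≤ 1
    fibre v |v|≡p = ≤-trans (count-mono k (λ r _ → subst (λ z → T (take k (v ++ r) == z)) (drop-++ r |v|≡p)))
                           (count-self-overlapping k v (subst (1 ≤_) (sym |v|≡p) 1≤p))

  hasClosedBorder : ℕ → ℕ → Word q → Bool
  hasClosedBorder n k u =
    (0 <ᵇ k) ∧ (k <ᵇ n) ∧ (take k u == drop (n ∸ k) u) ∧ (occurrences (take k u) u ≡ᵇ 2)

  record ClosedBorder (n k : ℕ) (u : Word q) : Set where
    field
      k>0    : 0 < k
      k<n    : k < n
      border : take k u ≡ drop (n ∸ k) u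
      twice  : occurrences (take k u) u ≡ 2

  closedBorder : ∀ {n k} u → T (hasClosedBorder n k u) → ClosedBorder n k u
  closedBorder {n} {k} u h =
    let (h₁ , h₂₃₄) = split (0 <ᵇ k) _ h
        (h₂ , h₃₄)  = split (k <ᵇ n) _ h₂₃₄
        (h₃ , h₄)   = split (take k u == drop (n ∸ k) u) _ h₃₄
    in record { k>0 = <ᵇ⇒< 0 k h₁ ; k<n = <ᵇ⇒< k n h₂ ; border = ==⇒≡ h₃ ; twice = ≡ᵇ⇒≡ _ 2 h₄ }
    where
    split : ∀ a b → T (a ∧ b) → T a × T b
    split a b = Equivalence.to (T-∧ {a} {b})

  closedBorder-no-inner-occurrence : ∀ {n k} u → length u ≡ n → ClosedBorder n k u →
    ∀ i → 0 < i → i + k < n → take k (drop i u) ≢ take k u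
  closedBorder-no-inner-occurrence {n} {k} u refl c i 0<i i+k<n inner =
    contradiction (subst (3 ≤_) twice three-occurrences) (<⇒≱ (n<1+n 2))
    where
    open ClosedBorder c
    k≤n = <⇒≤ k<n
    p = n ∸ k
    |w|≡k : length (take k u) ≡ k
    |w|≡k = trans (List.length-take k u) (m≤n⇒m⊓n≡m k≤n)
    suffix : take k (drop p u) ≡ take k u
    suffix = trans (List.take-all k (drop p u) (≤-reflexive |suffix|≡k)) (sym border)
      where
      |suffix|≡k : length (drop p u) ≡ k
      |suffix|≡k = trans (List.length-drop p u) (m∸[m∸n]≡n k≤n)
    i<p : i < p
    i<p = +-cancelʳ-< k i p (subst (i + k <_) (sym (m∸n+n≡m k≤n)) i+k<n)
    three-occurrences : 3 ≤ occurrences (take k u) u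
    three-occurrences = three-hits (occursAt (take k u) u) 0<i i<p (s≤s (m∸n≤m n k))
      (occurs 0 |w|≡k k≤n refl)
      (occurs i |w|≡k (<⇒≤ i+k<n) inner)
      (occurs p |w|≡k (≤-reflexive (m∸n+n≡m k≤n)) suffix)

  avoidsBlocks : Word q → ℕ → ℕ → Word q → Bool
  avoidsBlocks w k zero    r = true
  avoidsBlocks w k (suc m) r = not (take k r == w) ∧ avoidsBlocks w k m (drop k r)

  avoidsBlocks-intro : ∀ w k m r → (∀ j → j < m → take k (drop (j * k) r) ≢ w) → T (avoidsBlocks w k m r)
  avoidsBlocks-intro w k zero    r _      = _
  avoidsBlocks-intro w k (suc m) r differ = Equivalence.from T-∧
    ( ≢⇒not== (differ 0 z<s)
    , avoidsBlocks-intro w k m (drop k r) (λ j j<m →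
        differ (suc j) (s<s j<m) ∘ trans (cong (take k) (sym (List.drop-drop k (j * k) r)))))

  count-avoidsBlocks : ∀ w k m ℓ → length w ≡ k →
    count (avoidsBlocks w k m) (m * k + ℓ) ≤ (q ^ k ∸ 1) ^ m * q ^ ℓ
  count-avoidsBlocks w k zero    ℓ _    = ≤-reflexive (trans (count-all ℓ) (sym (*-identityˡ (q ^ ℓ))))
  count-avoidsBlocks w k (suc m) ℓ refl = begin
    count (avoidsBlocks w k (suc m)) (k + m * k + ℓ)
      ≡⟨ cong (count (avoidsBlocks w k (suc m))) (+-assoc k (m * k) ℓ) ⟩
    count (avoidsBlocks w k (suc m)) (k + (m * k + ℓ))
      ≤⟨ count-++-≤ _ (λ v → not (v == w)) X k (m * k + ℓ) fibre ⟩
    count (λ v → not (v == w)) k * X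
      ≤⟨ *-monoˡ-≤ X (count-not-≤ (_== w) w (≡⇒== refl)) ⟩
    (q ^ k ∸ 1) * X
      ≤⟨ *-monoʳ-≤ (q ^ k ∸ 1) (count-avoidsBlocks w k m ℓ refl) ⟩
    (q ^ k ∸ 1) * ((q ^ k ∸ 1) ^ m * q ^ ℓ)
      ≡⟨ *-assoc (q ^ k ∸ 1) _ _ ⟨
    (q ^ k ∸ 1) ^ suc m * q ^ ℓ ∎
    where
    open ≤-Reasoning
    X = count (avoidsBlocks w k m) (m * k + ℓ)
    fibre : ∀ v → length v ≡ k →
      count (λ r → avoidsBlocks w k (suc m) (v ++ r)) (m * k + ℓ) ≤ indicator (not (v == w)) * X
    fibre v |v|≡k = begin
      count (λ r → avoidsBlocks w k (suc m) (v ++ r)) (m * k + ℓ)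
        ≤⟨ count-mono (m * k + ℓ) (λ r _ → subst₂ (λ x y → T (not (x == w) ∧ avoidsBlocks w k m y))
                                          (take-++ r |v|≡k) (drop-++ r |v|≡k)) ⟩
      count (λ r → not (v == w) ∧ avoidsBlocks w k m r) (m * k + ℓ)
        ≤⟨ count-∧ (not (v == w)) (avoidsBlocks w k m) (m * k + ℓ) ⟩
      indicator (not (v == w)) * X ∎

  count-closedBorder≤q^[n∸k] : ∀ n k → count (hasClosedBorder n k) n ≤ q ^ (n ∸ k)
  count-closedBorder≤q^[n∸k] n k with k <? n
  ... | no k≮n = ≤-trans (≤-reflexive (count-none n (λ u _ → k≮n ∘ ClosedBorder.k<n ∘ closedBorder u))) z≤n
  ... | yes k<n = begin
    count (hasClosedBorder n k) n
      ≤⟨ count-mono n (λ u _ → ≡⇒== ∘ ClosedBorder.border ∘ closedBorder u) ⟩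
    count (λ u → take k u == drop (n ∸ k) u) n
      ≡⟨ cong (count (λ u → take k u == drop (n ∸ k) u)) (m∸n+n≡m (<⇒≤ k<n)) ⟨
    count (λ u → take k u == drop (n ∸ k) u) (n ∸ k + k)
      ≤⟨ count-periodic (n ∸ k) k (m<n⇒0<n∸m k<n) ⟩
    q ^ (n ∸ k) ∎
    where open ≤-Reasoning

  count-closedBorder≤blocks : ∀ k m ℓ → 0 < ℓ →
    count (hasClosedBorder (k + (m * k + ℓ)) k) (k + (m * k + ℓ)) ≤ q ^ k * ((q ^ k ∸ 1) ^ m * q ^ ℓ)
  count-closedBorder≤blocks k m ℓ 0<ℓ = begin
    count (hasClosedBorder n k) n
      ≤⟨ count-mono n closed⇒avoids ⟩
    count (λ u → avoidsBlocks (take k u) k m (drop k u)) (k + (m * k + ℓ))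
      ≤⟨ count-++-≤ _ (λ _ → true) X k (m * k + ℓ) fibre ⟩
    count (λ _ → true) k * X
      ≡⟨ cong (_* X) (count-all k) ⟩
    q ^ k * X ∎
    where
    open ≤-Reasoning
    n = k + (m * k + ℓ)
    X = (q ^ k ∸ 1) ^ m * q ^ ℓ
    block-inside : ∀ j → j < m → k + j * k + k < n
    block-inside j j<m = begin-strict
      k + j * k + k   ≤⟨ +-monoˡ-≤ k (*-monoˡ-≤ k j<m) ⟩
      m * k + k       <⟨ m<m+n (m * k + k) 0<ℓ ⟩
      m * k + k + ℓ   ≡⟨ rearrange (m * k) k ℓ ⟩
      n               ∎
      where
      rearrange : ∀ a b c → a + b + c ≡ b + (a + c)
      rearrange = solve-∀
    closed⇒avoids : ∀ u → length u ≡ n → T (hasClosedBorder n k u) →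
      T (avoidsBlocks (take k u) k m (drop k u))
    closed⇒avoids u |u|≡n h = avoidsBlocks-intro (take k u) k m (drop k u) λ j j<m →
      closedBorder-no-inner-occurrence u |u|≡n c (k + j * k) (≤-trans k>0 (m≤m+n k (j * k))) (block-inside j j<m)
      ∘ trans (cong (take k) (sym (List.drop-drop k (j * k) u)))
      where
      c = closedBorder u h
      open ClosedBorder c using (k>0)
    fibre : ∀ v → length v ≡ k →
      count (λ r → avoidsBlocks (take k (v ++ r)) k m (drop k (v ++ r))) (m * k + ℓ) ≤ indicator true * X
    fibre v |v|≡k = begin
      count (λ r → avoidsBlocks (take k (v ++ r)) k m (drop k (v ++ r))) (m * k + ℓ)
        ≤⟨ count-mono (m * k + ℓ) (λ r _ → subst₂ (λ x y → T (avoidsBlocks x k m y)) (take-++ r |v|≡k) (drop-++ r |v|≡k)) ⟩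
      count (avoidsBlocks v k m) (m * k + ℓ)
        ≤⟨ count-avoidsBlocks v k m ℓ |v|≡k ⟩
      X
        ≡⟨ *-identityˡ X ⟨
      indicator true * X ∎

  B≤sumBelow-count-closedBorder : ∀ n → B q n ≤ sumBelow (λ k → count (hasClosedBorder n k) n) n
  B≤sumBelow-count-closedBorder n = ≤-trans
    (count-mono n (λ u |u|≡n → subst (λ m → T (any (λ k → hasClosedBorder m k u) (upTo m))) |u|≡n))
    (count-any≤sumBelow (hasClosedBorder n) (λ k → k) n n)

  2^t*count-closedBorder≤q^n : 2 ≤ q → ∀ {k t n} → 1 ≤ k → k + q ^ k * t * k < n →
    2 ^ t * count (hasClosedBorder n k) n ≤ q ^ n
  2^t*count-closedBorder≤q^n q≥2 {k} {t} {n} k≥1 prefix<n = begin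
    2 ^ t * count (hasClosedBorder n k) n  ≤⟨ *-monoʳ-≤ (2 ^ t) N≤blocks ⟩
    2 ^ t * (Q * ((Q ∸ 1) ^ m * q ^ ℓ))    ≡⟨ reorder (2 ^ t) Q ((Q ∸ 1) ^ m) (q ^ ℓ) ⟩
    Q * q ^ ℓ * (2 ^ t * (Q ∸ 1) ^ m)      ≤⟨ *-monoʳ-≤ (Q * q ^ ℓ) (2^t*[Q∸1]^[Q*t]≤Q^[Q*t] t (≤-trans (s≤s z≤n) (2≤q^k q≥2 k≥1))) ⟩
    q ^ k * q ^ ℓ * (q ^ k) ^ m            ≡⟨ cong₂ _*_ (sym (^-distribˡ-+-* q k ℓ)) (^-*-assoc q k m) ⟩
    q ^ (k + ℓ) * q ^ (k * m)              ≡⟨ ^-distribˡ-+-* q (k + ℓ) (k * m) ⟨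
    q ^ (k + ℓ + k * m)                    ≡⟨ cong (q ^_) (trans (reorder′ k ℓ m) n≡k+[mk+ℓ]) ⟩
    q ^ n                                  ∎
    where
    open ≤-Reasoning
    Q = q ^ k
    m = Q * t
    ℓ = n ∸ (k + m * k)
    n≡k+[mk+ℓ] : k + (m * k + ℓ) ≡ n
    n≡k+[mk+ℓ] = trans (sym (+-assoc k (m * k) ℓ)) (m+[n∸m]≡n (<⇒≤ prefix<n))
    N≤blocks : count (hasClosedBorder n k) n ≤ Q * ((Q ∸ 1) ^ m * q ^ ℓ)
    N≤blocks = subst (λ n → count (hasClosedBorder n k) n ≤ Q * ((Q ∸ 1) ^ m * q ^ ℓ)) n≡k+[mk+ℓ]
                     (count-closedBorder≤blocks k m ℓ (m<n⇒0<n∸m prefix<n))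
    reorder : ∀ a b c d → a * (b * (c * d)) ≡ b * d * (a * c)
    reorder = solve-∀
    reorder′ : ∀ k ℓ m → k + ℓ + k * m ≡ k + (m * k + ℓ)
    reorder′ = solve-∀

  s*count-closedBorder≤4*q^n : 2 ≤ q → ∀ {k s n} → 1 ≤ k → k * q ^ k ≤ s → s * s ≤ n →
    s * count (hasClosedBorder n k) n ≤ 4 * q ^ n
  s*count-closedBorder≤4*q^n q≥2 {k} {s} {n} k≥1 kQ≤s s²≤n
    with ≤-trans (*-mono-≤ k≥1 (2≤q^k q≥2 k≥1)) kQ≤s
  -- s = t + 2, and the block bound is used with m = q^k t blocks.
  ... | s≤s (s≤s {n = t} _) = begin
    s * N             ≤⟨ *-monoˡ-≤ N (n≤4*2^[n∸2] s) ⟩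
    4 * 2 ^ t * N     ≡⟨ *-assoc 4 (2 ^ t) N ⟩
    4 * (2 ^ t * N)   ≤⟨ *-monoʳ-≤ 4 (2^t*count-closedBorder≤q^n q≥2 k≥1 prefix<n) ⟩
    4 * q ^ n         ∎
    where
    open ≤-Reasoning
    N = count (hasClosedBorder n k) n
    Q = q ^ k
    k≤s : k ≤ s
    k≤s = ≤-trans (m≤m*n k Q {{>-nonZero (≤-trans (s≤s z≤n) (2≤q^k q≥2 k≥1))}}) kQ≤s
    prefix<n : k + Q * t * k < n
    prefix<n = begin-strict
      k + Q * t * k      ≡⟨ cong (k +_) (reorder Q t k) ⟩
      k + t * (k * Q)    ≤⟨ +-mono-≤ k≤s (*-monoʳ-≤ t kQ≤s) ⟩
      s + t * s          <⟨ +-monoʳ-< s (m<n+m (t * s) z<s) ⟩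
      s * s              ≤⟨ s²≤n ⟩
      n                  ∎
      where
      reorder : ∀ Q t k → Q * t * k ≡ t * (k * Q)
      reorder = solve-∀

  s*B≤12*⌊log₂n⌋*q^n : 2 ≤ q → ∀ {n s} → 2 ≤ n → s * s ≤ n → s * B q n ≤ 12 * ⌊log₂ n ⌋ * q ^ n
  s*B≤12*⌊log₂n⌋*q^n q≥2 {n} {s} n≥2 s²≤n = begin
    s * B q n                           ≤⟨ *-monoʳ-≤ s (B≤sumBelow-count-closedBorder n) ⟩
    s * sumBelow N n                    ≡⟨ *-distribˡ-sumBelow s N n ⟩
    sumBelow (λ k → s * N k) n          ≤⟨ sumBelow-≤-threshold q≥2 n K (4 * q ^ n) s K≤n short long ⟩
    K * (4 * q ^ n) + 2 * s * q ^ (n ∸ K)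
      ≤⟨ +-monoʳ-≤ (K * (4 * q ^ n)) (≤-trans (≤-reflexive (*-assoc 2 s _)) (*-monoʳ-≤ 2 s*q^[n∸K]≤K*q^n)) ⟩
    K * (4 * q ^ n) + 2 * (K * q ^ n)   ≡⟨ collect K (q ^ n) ⟩
    6 * K * q ^ n                       ≤⟨ *-monoˡ-≤ (q ^ n) (*-monoʳ-≤ 6 K≤2⌊log₂n⌋) ⟩
    6 * (2 * ⌊log₂ n ⌋) * q ^ n         ≡⟨ cong (_* q ^ n) (*-assoc 6 2 ⌊log₂ n ⌋) ⟨
    12 * ⌊log₂ n ⌋ * q ^ n              ∎
    where
    open ≤-Reasoning
    open Threshold (threshold {q} {s} {n} q≥2 n≥2 s²≤n)
    N = λ k → count (hasClosedBorder n k) n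
    short : ∀ k → k < K → s * N k ≤ 4 * q ^ n
    short zero    _   = ≤-trans (≤-reflexive (trans (cong (s *_) N0≡0) (*-zeroʳ s))) z≤n
      where
      N0≡0 : N 0 ≡ 0
      N0≡0 = count-none n (λ u _ → (λ ()) ∘ ClosedBorder.k>0 ∘ closedBorder {n} {0} u)
    short (suc k) k<K = s*count-closedBorder≤4*q^n q≥2 (s≤s z≤n) (below k<K) s²≤n
    long : ∀ k → K ≤ k → k < n → s * N k ≤ s * q ^ (n ∸ k)
    long k _ _ = *-monoʳ-≤ s (count-closedBorder≤q^[n∸k] n k)
    s*q^[n∸K]≤K*q^n : s * q ^ (n ∸ K) ≤ K * q ^ n
    s*q^[n∸K]≤K*q^n = begin
      s * q ^ (n ∸ K)               ≤⟨ *-monoˡ-≤ (q ^ (n ∸ K)) s≤K*q^K ⟩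
      K * q ^ K * q ^ (n ∸ K)       ≡⟨ *-assoc K (q ^ K) _ ⟩
      K * (q ^ K * q ^ (n ∸ K))     ≡⟨ cong (K *_) (^-distribˡ-+-* q K (n ∸ K)) ⟨
      K * q ^ (K + (n ∸ K))         ≡⟨ cong (λ e → K * q ^ e) (m+[n∸m]≡n K≤n) ⟩
      K * q ^ n                     ∎
    collect : ∀ K Q → K * (4 * Q) + 2 * (K * Q) ≡ 6 * K * Q
    collect = solve-∀

theorem2 : (q : ℕ) → 1 < q →
    Σ ℕ (λ C → (n : ℕ) → 1 < n →
    n * (B q n ^ 2) ≤ C * (⌊log₂ n ⌋ ^ 2) * (q ^ (2 * n)))
theorem2 q q>1 = 576 , bound
  where
  open Words q
  bound : (n : ℕ) → 1 < n → n * (B q n ^ 2) ≤ 576 * (⌊log₂ n ⌋ ^ 2) * (q ^ (2 * n))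
  bound n n>1 with √-bounds n
  ... | zero  , _    , n<1              = contradiction (≤-trans n>1 (s≤s⁻¹ n<1)) λ ()
  ... | suc r , s²≤n , n<[1+s]² = begin
    n * B q n ^ 2                          ≤⟨ *-monoˡ-≤ (B q n ^ 2) (<⇒≤ n<[1+s]²) ⟩
    suc s * suc s * B q n ^ 2              ≤⟨ *-monoˡ-≤ (B q n ^ 2) (*-mono-≤ 1+s≤s+s 1+s≤s+s) ⟩
    (s + s) * (s + s) * B q n ^ 2          ≡⟨ square s (B q n) ⟩
    4 * (s * B q n) ^ 2                    ≤⟨ *-monoʳ-≤ 4 (^-monoˡ-≤ 2 (s*B≤12*⌊log₂n⌋*q^n q>1 {n} {s} n>1 s²≤n)) ⟩
    4 * (12 * ⌊log₂ n ⌋ * q ^ n) ^ 2       ≡⟨ square′ ⌊log₂ n ⌋ (q ^ n) ⟩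
    576 * ⌊log₂ n ⌋ ^ 2 * (q ^ n * q ^ n)  ≡⟨ cong (576 * ⌊log₂ n ⌋ ^ 2 *_) (^-distribˡ-+-* q n n) ⟨
    576 * ⌊log₂ n ⌋ ^ 2 * q ^ (n + n)      ≡⟨ cong (λ e → 576 * ⌊log₂ n ⌋ ^ 2 * q ^ (n + e)) (+-identityʳ n) ⟨
    576 * ⌊log₂ n ⌋ ^ 2 * q ^ (2 * n)      ∎
    where
    open ≤-Reasoning
    s = suc r
    1+s≤s+s : suc s ≤ s + s
    1+s≤s+s = +-monoˡ-≤ s (s≤s z≤n)
    square : ∀ x b → (x + x) * (x + x) * (b * (b * 1)) ≡ 4 * (x * b * (x * b * 1))
    square = solve-∀
    square′ : ∀ l Q → 4 * (12 * l * Q * (12 * l * Q * 1)) ≡ 576 * (l * (l * 1)) * (Q * Q)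
    square′ = solve-∀
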